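{- The matroids $F_8$ and $\mathrm{AG}(3,2)'$ (which are not representable over any field) are freely representable over $\mathbb{Z}/4\mathbb{Z}$.
   Context: $F_8$ and $\mathrm{AG}(3,2)'$ are the standard eight-element rank-4 matroids of Oxley's Matroid Theory appendix ($\mathrm{AG}(3,2)'$ is obtained from the binary affine cube by relaxing one circuit-hyperplane; concretely, with cube vertices labelled so that the four-point planes are the six faces, the six diagonal planes $\{a,b,g,h\},\{c,d,e,f\},\{a,d,f,g\},\{b,c,e,h\},\{a,c,e,g\},\{b,d,f,h\}$, and the twisted plane $\{b,d,e,g\}$). For the local ring $R=\mathbb{Z}/4\mathbb{Z}$ with maximal ideal $\mathfrak{m}=2R$, vectors $v_1,\dots,v_\ell$ are modular independent if $\sum\alpha_iv_i=0$ implies all $\alpha_i\in\mathfrak{m}$. For a $k\times|E|$ matrix $A$ over $R$ with columns indexed by $E$, $M[A]$ is the independence system on $E$ whose independent sets are the sets of columns that are modular independent. A matroid $M$ is freely representable over $R$ if $M\cong M[A]$ for some $k\times|E(M)|$ matrix $A$ over $R$ which, after a permutation of columns, has the form $[I_k\mid P]$. -}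

module Defs where

open import Data.Nat using (ℕ; zero; suc; _+_; _≤_)
open import Data.Nat.DivMod using (_mod_)
open import Data.Fin using (Fin; toℕ; splitAt)
open import Data.Fin.Patterns using (0F; 1F; 2F; 3F; 4F; 5F; 6F; 7F)
import Data.Fin.Properties as FinP
open import Data.Bool using (Bool; true; false)
open import Data.List using (List; []; _∷_; _++_)
open import Data.List.Relation.Unary.Any using (Any)
open import Data.Product using (Σ; _×_)
open import Data.Sum using (_⊎_; [_,_])
open import Relation.Nullary using (¬_; does)
open import Relation.Binary.PropositionalEquality using (_≡_)
open import Function.Bundles using (_↔_; _⇔_; Inverse)

ℤ₄ : Set
ℤ₄ = Fin 4

infixl 6 _+₄_
infixl 7 _*₄_

_+₄_ : ℤ₄ → ℤ₄ → ℤ₄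
x +₄ y = (toℕ x + toℕ y) mod 4

_*₄_ : ℤ₄ → ℤ₄ → ℤ₄
x *₄ y = (toℕ x Data.Nat.* toℕ y) mod 4

0₄ 1₄ 2₄ : ℤ₄
0₄ = 0F
1₄ = 1F
2₄ = 2F

InMaxIdeal : ℤ₄ → Set
InMaxIdeal x = Σ ℤ₄ λ r → x ≡ 2₄ *₄ r

sum₄ : ∀ {n} → (Fin n → ℤ₄) → ℤ₄
sum₄ {zero}  f = 0₄
sum₄ {suc n} f = f Data.Fin.zero +₄ sum₄ (λ i → f (Data.Fin.suc i))

Sub : ℕ → Set
Sub n = Fin n → Bool

card : ∀ {n} → Sub n → ℕ
card {zero}  X = 0
card {suc n} X with X Data.Fin.zero
... | true  = suc (card (λ i → X (Data.Fin.suc i)))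
... | false = card (λ i → X (Data.Fin.suc i))

IndepSystem : ℕ → Set₁
IndepSystem n = Sub n → Set

-- isomorphism: a bijection of ground sets f with  X independent in M  iff
-- f(X) independent in N  (f(X) has characteristic function X ∘ f⁻¹)
_≅_ : ∀ {n n′} → IndepSystem n → IndepSystem n′ → Set
_≅_ {n} {n′} M N =
  Σ (Fin n ↔ Fin n′) λ f → ∀ (X : Sub n) → M X ⇔ N (λ y → X (Inverse.from f y))

-- k × n matrix, A i e = entry in row i, column e
Mat : ℕ → ℕ → Set
Mat k n = Fin k → Fin n → ℤ₄

ModIndep : ∀ {k n} → Mat k n → Sub n → Set
ModIndep {k} {n} A X =
  (α : Fin n → ℤ₄) →
  (∀ e → X e ≡ false → α e ≡ 0₄) →
  (∀ i → sum₄ (λ e → α e *₄ A i e) ≡ 0₄) →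
  ∀ e → InMaxIdeal (α e)

M[_] : ∀ {k n} → Mat k n → IndepSystem n
M[ A ] = ModIndep A

I-mat : ∀ k → Mat k k
I-mat k i j with does (i FinP.≟ j)
... | true  = 1₄
... | false = 0₄

[I∣_] : ∀ {k m} → Mat k m → Mat k (k + m)
[I∣_] {k} {m} P i j = [ (λ j₁ → I-mat k i j₁) , (λ j₂ → P i j₂) ] (splitAt k j)

FreelyRepresentableℤ₄ : ∀ {n} → IndepSystem n → Set
FreelyRepresentableℤ₄ {n} M =
  Σ ℕ λ k → Σ ℕ λ m → Σ (Mat k m) λ P → Σ (Mat k n) λ A →
  Σ (Fin n ↔ Fin (k + m)) λ σ →
    (∀ i e → A i e ≡ [I∣ P ] i (Inverse.to σ e)) × (M ≅ M[ A ])

-- Rank-4 sparse paving matroids on 8 elements given by their list of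
-- circuit-hyperplanes (4-point planes): X is independent iff |X| ≤ 3, or
-- |X| = 4 and X is not one of the listed 4-point planes.

memb : ∀ {n} → Fin n → List (Fin n) → Bool
memb e []       = false
memb e (x ∷ xs) with does (e FinP.≟ x)
... | true  = true
... | false = memb e xs

IsSet : ∀ {n} → Sub n → List (Fin n) → Set
IsSet X p = ∀ e → X e ≡ memb e p

SparsePaving4 : List (List (Fin 8)) → IndepSystem 8
SparsePaving4 planes X =
  card X ≤ 3 ⊎ (card X ≡ 4 × ¬ Any (IsSet X) planes)

-- cube vertices a,…,h  (bottom face a b c d in cyclic order, top face
-- e f g h with e above a, f above b, g above c, h above d)
va vb vc vd ve vf vg vh : Fin 8
va = 0F
vb = 1F
vc = 2F
vd = 3F
ve = 4F
vf = 5F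
vg = 6F
vh = 7F

faces : List (List (Fin 8))
faces = (va ∷ vb ∷ vc ∷ vd ∷ []) ∷ (ve ∷ vf ∷ vg ∷ vh ∷ []) ∷
        (va ∷ vb ∷ ve ∷ vf ∷ []) ∷ (vb ∷ vc ∷ vf ∷ vg ∷ []) ∷
        (vc ∷ vd ∷ vg ∷ vh ∷ []) ∷ (va ∷ vd ∷ ve ∷ vh ∷ []) ∷ []

diagonals : List (List (Fin 8))
diagonals = (va ∷ vb ∷ vg ∷ vh ∷ []) ∷ (vc ∷ vd ∷ ve ∷ vf ∷ []) ∷
            (va ∷ vd ∷ vf ∷ vg ∷ []) ∷ (vb ∷ vc ∷ ve ∷ vh ∷ []) ∷
            (va ∷ vc ∷ ve ∷ vg ∷ []) ∷ (vb ∷ vd ∷ vf ∷ vh ∷ []) ∷ []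

-- AG(3,2)′: AG(3,2) with the circuit-hyperplane {a,c,f,h} relaxed;
-- 4-point planes: six faces, six diagonal planes, twisted plane {b,d,e,g}
AG32′-planes : List (List (Fin 8))
AG32′-planes = faces ++ diagonals ++ ((vb ∷ vd ∷ ve ∷ vg ∷ []) ∷ [])

AG32′ : IndepSystem 8
AG32′ = SparsePaving4 AG32′-planes

-- F₈: AG(3,2) with two non-disjoint circuit-hyperplanes relaxed; here
-- AG(3,2)′ (where {a,c,f,h} is relaxed) with the further circuit-hyperplane
-- {e,f,g,h} (meeting {a,c,f,h} in {f,h}) relaxed.  4-point planes: the five
-- faces other than {e,f,g,h}, the six diagonal planes, twisted plane {b,d,e,g}
F8-planes : List (List (Fin 8))
F8-planes = (va ∷ vb ∷ vc ∷ vd ∷ []) ∷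
            (va ∷ vb ∷ ve ∷ vf ∷ []) ∷ (vb ∷ vc ∷ vf ∷ vg ∷ []) ∷
            (vc ∷ vd ∷ vg ∷ vh ∷ []) ∷ (va ∷ vd ∷ ve ∷ vh ∷ []) ∷
            []

F8 : IndepSystem 8
F8 = SparsePaving4 (F8-planes ++ diagonals ++ ((vb ∷ vd ∷ ve ∷ vg ∷ []) ∷ []))

{-# OPTIONS --safe #-}
-- Over ℤ/4ℤ the kernel of [I ∣ P] consists exactly of the vectors (−Pβ, β), so a set X of
-- columns is modular independent iff every such vector supported on X has all its entries
-- in 𝔪 = 2ℤ/4ℤ.  Independence in M[[I ∣ P]] is thereby decided by a search over the 4^m
-- choices of β, and each of F₈ and AG(3,2)′ is matched with M[[I ∣ P]] for a suitable P
-- and column labelling by an exhaustive check over all 2^8 subsets of the ground set.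
module Submission where

open import Defs
open import Data.Bool using (Bool; true; false)
import Data.Bool.Properties as Bool
open import Data.Fin using (Fin; zero; suc; splitAt; _↑ˡ_; _↑ʳ_)
open import Data.Fin.Patterns using (0F; 1F; 2F; 3F; 4F; 5F; 6F; 7F)
open import Data.Fin.Properties
  using (_≟_; all?; any?; suc-injective; splitAt-↑ˡ; splitAt-↑ʳ; splitAt⁻¹-↑ˡ; splitAt⁻¹-↑ʳ)
import Data.List.Relation.Unary.Any as Any
open import Data.Nat using (zero; suc; _+_; _≤_; _≤?_)
import Data.Nat.Properties as ℕ
open import Data.Product using (_×_; _,_; uncurry)
open import Data.Sum using (inj₁; inj₂; [_,_])
open import Data.Vec using (Vec; []; _∷_; lookup)
open import Data.Vec.Functional using (Vector; head; tail)
import Data.Vec.Functional as Vector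
open import Data.Vec.Functional.Properties using (∷-cong)
open import Function using (_∘_)
open import Function.Bundles using (_↔_; _⇔_; mk⇔; mk↔ₛ′; Inverse; Equivalence)
open import Function.Construct.Identity using (↔-id)
open import Relation.Binary.Definitions using (_Respects_)
open import Relation.Binary.PropositionalEquality
  using (_≡_; _≢_; _≗_; refl; sym; trans; cong; cong₂; subst; module ≡-Reasoning)
open import Relation.Nullary using (Dec; yes; no; does; ¬?; _×-dec_; _⊎-dec_; _→-dec_)
open import Relation.Nullary.Decidable using (map′; from-yes; dec-true; dec-false)
open import Relation.Unary using (Decidable)

infix 8 -₄_

-₄_ : ℤ₄ → ℤ₄
-₄ 0F = 0F
-₄ 1F = 3F
-₄ 2F = 2F
-₄ 3F = 1F

+₄-identityˡ : ∀ x → 0₄ +₄ x ≡ x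
+₄-identityˡ = from-yes (all? λ x → 0₄ +₄ x ≟ x)

+₄-identityʳ : ∀ x → x +₄ 0₄ ≡ x
+₄-identityʳ = from-yes (all? λ x → x +₄ 0₄ ≟ x)

+₄-assoc : ∀ x y z → (x +₄ y) +₄ z ≡ x +₄ (y +₄ z)
+₄-assoc = from-yes (all? λ x → all? λ y → all? λ z → (x +₄ y) +₄ z ≟ x +₄ (y +₄ z))

-₄-inverseˡ : ∀ x → -₄ x +₄ x ≡ 0₄
-₄-inverseˡ = from-yes (all? λ x → -₄ x +₄ x ≟ 0₄)

+₄≡0⇒≡-₄ : ∀ x y → x +₄ y ≡ 0₄ → x ≡ -₄ y
+₄≡0⇒≡-₄ = from-yes (all? λ x → all? λ y → x +₄ y ≟ 0₄ →-dec x ≟ -₄ y)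

*₄-zeroʳ : ∀ x → x *₄ 0₄ ≡ 0₄
*₄-zeroʳ = from-yes (all? λ x → x *₄ 0₄ ≟ 0₄)

*₄-identityʳ : ∀ x → x *₄ 1₄ ≡ x
*₄-identityʳ = from-yes (all? λ x → x *₄ 1₄ ≟ x)

sum₄-cong : ∀ {n} {f g : Fin n → ℤ₄} → f ≗ g → sum₄ f ≡ sum₄ g
sum₄-cong {zero}  f≗g = refl
sum₄-cong {suc n} f≗g = cong₂ _+₄_ (f≗g zero) (sum₄-cong (f≗g ∘ suc))

sum₄-zero : ∀ {n} {f : Fin n → ℤ₄} → (∀ j → f j ≡ 0₄) → sum₄ f ≡ 0₄
sum₄-zero {zero}  f≡0 = refl
sum₄-zero {suc n} f≡0 = cong₂ _+₄_ (f≡0 zero) (sum₄-zero (f≡0 ∘ suc))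

sum₄-single : ∀ {n} (f : Fin n → ℤ₄) i → (∀ j → j ≢ i → f j ≡ 0₄) → sum₄ f ≡ f i
sum₄-single f zero f≡0 =
  trans (cong (f zero +₄_) (sum₄-zero λ j → f≡0 (suc j) λ ())) (+₄-identityʳ (f zero))
sum₄-single f (suc i) f≡0 =
  trans (cong₂ _+₄_ (f≡0 zero λ ())
                    (sum₄-single (f ∘ suc) i λ j j≢i → f≡0 (suc j) (j≢i ∘ suc-injective)))
        (+₄-identityˡ (f (suc i)))

sum₄-splitAt : ∀ k {m} (f : Fin (k + m) → ℤ₄) →
               sum₄ f ≡ sum₄ (λ i → f (i ↑ˡ m)) +₄ sum₄ (λ j → f (k ↑ʳ j))
sum₄-splitAt zero    f = sym (+₄-identityˡ (sum₄ f))
sum₄-splitAt (suc k) {m} f =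
  trans (cong (f zero +₄_) (sum₄-splitAt k (f ∘ suc)))
        (sym (+₄-assoc (f zero) (sum₄ λ i → f (suc (i ↑ˡ m))) (sum₄ λ j → f (suc (k ↑ʳ j)))))

I-mat-diag : ∀ k i → I-mat k i i ≡ 1₄
I-mat-diag k i rewrite dec-true (i ≟ i) refl = refl

I-mat-offdiag : ∀ k {i j} → i ≢ j → I-mat k i j ≡ 0₄
I-mat-offdiag k {i} {j} i≢j rewrite dec-false (i ≟ j) i≢j = refl

infixr 9 _*ᵥ_

_*ᵥ_ : ∀ {k n} → Mat k n → (Fin n → ℤ₄) → Fin k → ℤ₄
(A *ᵥ α) i = sum₄ (λ e → α e *₄ A i e)

*ᵥ-congʳ : ∀ {k n} (A : Mat k n) {α β : Fin n → ℤ₄} → α ≗ β → A *ᵥ α ≗ A *ᵥ β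
*ᵥ-congʳ A α≗β i = sum₄-cong λ e → cong (_*₄ A i e) (α≗β e)

[I∣P]-↑ˡ : ∀ {k m} (P : Mat k m) i j → [I∣ P ] i (j ↑ˡ m) ≡ I-mat k i j
[I∣P]-↑ˡ {k} {m} P i j = cong [ _ , _ ] (splitAt-↑ˡ k j m)

[I∣P]-↑ʳ : ∀ {k m} (P : Mat k m) i j → [I∣ P ] i (k ↑ʳ j) ≡ P i j
[I∣P]-↑ʳ {k} {m} P i j = cong [ _ , _ ] (splitAt-↑ʳ k m j)

[I∣P]*ᵥ : ∀ {k m} (P : Mat k m) (α : Fin (k + m) → ℤ₄) i →
          ([I∣ P ] *ᵥ α) i ≡ α (i ↑ˡ m) +₄ (P *ᵥ (α ∘ (k ↑ʳ_))) i
[I∣P]*ᵥ {k} {m} P α i =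
  trans (sum₄-splitAt k _) (cong₂ _+₄_ identityBlock blockP)
  where
  open ≡-Reasoning
  offDiagonal : ∀ j → j ≢ i → α (j ↑ˡ m) *₄ [I∣ P ] i (j ↑ˡ m) ≡ 0₄
  offDiagonal j j≢i = begin
    α (j ↑ˡ m) *₄ [I∣ P ] i (j ↑ˡ m) ≡⟨ cong (α (j ↑ˡ m) *₄_) ([I∣P]-↑ˡ P i j) ⟩
    α (j ↑ˡ m) *₄ I-mat k i j         ≡⟨ cong (α (j ↑ˡ m) *₄_) (I-mat-offdiag k (j≢i ∘ sym)) ⟩
    α (j ↑ˡ m) *₄ 0₄                  ≡⟨ *₄-zeroʳ (α (j ↑ˡ m)) ⟩
    0₄                                ∎
  identityBlock : sum₄ (λ j → α (j ↑ˡ m) *₄ [I∣ P ] i (j ↑ˡ m)) ≡ α (i ↑ˡ m)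
  identityBlock = begin
    sum₄ (λ j → α (j ↑ˡ m) *₄ [I∣ P ] i (j ↑ˡ m)) ≡⟨ sum₄-single _ i offDiagonal ⟩
    α (i ↑ˡ m) *₄ [I∣ P ] i (i ↑ˡ m)              ≡⟨ cong (α (i ↑ˡ m) *₄_) ([I∣P]-↑ˡ P i i) ⟩
    α (i ↑ˡ m) *₄ I-mat k i i                      ≡⟨ cong (α (i ↑ˡ m) *₄_) (I-mat-diag k i) ⟩
    α (i ↑ˡ m) *₄ 1₄                               ≡⟨ *₄-identityʳ (α (i ↑ˡ m)) ⟩
    α (i ↑ˡ m)                                     ∎
  blockP : sum₄ (λ j → α (k ↑ʳ j) *₄ [I∣ P ] i (k ↑ʳ j)) ≡ (P *ᵥ (α ∘ (k ↑ʳ_))) i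
  blockP = sum₄-cong λ j → cong (α (k ↑ʳ j) *₄_) ([I∣P]-↑ʳ P i j)

IsKernelVector : ∀ {k n} → Mat k n → (Fin n → ℤ₄) → Set
IsKernelVector A α = ∀ i → (A *ᵥ α) i ≡ 0₄

kernelVector : ∀ {k m} → Mat k m → (Fin m → ℤ₄) → Fin (k + m) → ℤ₄
kernelVector {k} P β e = [ (λ i → -₄ (P *ᵥ β) i) , β ] (splitAt k e)

kernelVector-↑ˡ : ∀ {k m} (P : Mat k m) β i → kernelVector P β (i ↑ˡ m) ≡ -₄ (P *ᵥ β) i
kernelVector-↑ˡ {k} {m} P β i = cong [ _ , _ ] (splitAt-↑ˡ k i m)

kernelVector-↑ʳ : ∀ {k m} (P : Mat k m) β j → kernelVector P β (k ↑ʳ j) ≡ β j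
kernelVector-↑ʳ {k} {m} P β j = cong [ _ , _ ] (splitAt-↑ʳ k m j)

kernelVector-cong : ∀ {k m} (P : Mat k m) {β γ} → β ≗ γ → kernelVector P β ≗ kernelVector P γ
kernelVector-cong {k} P β≗γ e with splitAt k e
... | inj₁ i = cong -₄_ (*ᵥ-congʳ P β≗γ i)
... | inj₂ j = β≗γ j

kernelVector-isKernelVector : ∀ {k m} (P : Mat k m) β → IsKernelVector [I∣ P ] (kernelVector P β)
kernelVector-isKernelVector {k} {m} P β i = begin
  ([I∣ P ] *ᵥ kernelVector P β) i
    ≡⟨ [I∣P]*ᵥ P (kernelVector P β) i ⟩
  kernelVector P β (i ↑ˡ m) +₄ (P *ᵥ (kernelVector P β ∘ (k ↑ʳ_))) i
    ≡⟨ cong₂ _+₄_ (kernelVector-↑ˡ P β i) (*ᵥ-congʳ P (kernelVector-↑ʳ P β) i) ⟩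
  -₄ (P *ᵥ β) i +₄ (P *ᵥ β) i
    ≡⟨ -₄-inverseˡ ((P *ᵥ β) i) ⟩
  0₄ ∎
  where open ≡-Reasoning

kernelVector-unique : ∀ {k m} (P : Mat k m) α → IsKernelVector [I∣ P ] α →
                      α ≗ kernelVector P (α ∘ (k ↑ʳ_))
kernelVector-unique {k} {m} P α ker e with splitAt k e in eq
... | inj₁ i = subst (λ e → α e ≡ -₄ (P *ᵥ (α ∘ (k ↑ʳ_))) i) (splitAt⁻¹-↑ˡ eq)
                 (+₄≡0⇒≡-₄ _ _ (trans (sym ([I∣P]*ᵥ P α i)) (ker i)))
... | inj₂ j = cong α (sym (splitAt⁻¹-↑ʳ eq))

SupportedOn : ∀ {n} → Sub n → (Fin n → ℤ₄) → Set
SupportedOn X α = ∀ e → X e ≡ false → α e ≡ 0₄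

AllInMaxIdeal : ∀ {n} → (Fin n → ℤ₄) → Set
AllInMaxIdeal α = ∀ e → InMaxIdeal (α e)

modIndep-[I∣P]⇔ : ∀ {k m} (P : Mat k m) X →
  ModIndep [I∣ P ] X ⇔ (∀ β → SupportedOn X (kernelVector P β) → AllInMaxIdeal (kernelVector P β))
modIndep-[I∣P]⇔ {k} P X = mk⇔
  (λ indep β supp → indep (kernelVector P β) supp (kernelVector-isKernelVector P β))
  (λ h α supp ker →
    let α≗ = kernelVector-unique P α ker in
    λ e → subst InMaxIdeal (sym (α≗ e))
                (h (α ∘ (k ↑ʳ_)) (λ e′ Xe′ → trans (sym (α≗ e′)) (supp e′ Xe′)) e))

Exhaustible : Set → Set₁
Exhaustible A = ∀ {Q : A → Set} → Decidable Q → Dec (∀ a → Q a)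

Bool-exhaustible : Exhaustible Bool
Bool-exhaustible Q? =
  map′ (λ (qt , qf) → λ { true → qt ; false → qf }) (λ q → q true , q false)
       (Q? true ×-dec Q? false)

all-vectors? : ∀ n {A} → Exhaustible A → {Q : Vector A n → Set} →
               Q Respects _≗_ → Decidable Q → Dec (∀ v → Q v)
all-vectors? zero    all-A? resp Q? =
  map′ (λ q v → resp (λ ()) q) (λ q → q Vector.[]) (Q? Vector.[])
all-vectors? (suc n) all-A? resp Q? =
  map′ (λ q v → resp (∷-cong refl λ _ → refl) (q (head v) (tail v))) (λ q a v → q (a Vector.∷ v))
       (all-A? λ a → all-vectors? n all-A? (resp ∘ ∷-cong refl) (Q? ∘ (a Vector.∷_)))

-- Checking  refl : does a? ≡ true  costs Agda far less time and memory than the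
-- equivalent  from-yes a?  or  toWitness.
decided : ∀ {A : Set} (a? : Dec A) → does a? ≡ true → A
decided (yes a) _  = a
decided (no _)  ()

_⇔?_ : ∀ {A B : Set} → Dec A → Dec B → Dec (A ⇔ B)
A? ⇔? B? = map′ (uncurry mk⇔) (λ A⇔B → Equivalence.to A⇔B , Equivalence.from A⇔B)
                ((A? →-dec B?) ×-dec (B? →-dec A?))

inMaxIdeal? : Decidable InMaxIdeal
inMaxIdeal? x = any? λ r → x ≟ 2₄ *₄ r

supportedOn? : ∀ {n} (X : Sub n) → Decidable (SupportedOn X)
supportedOn? X α = all? λ e → X e Bool.≟ false →-dec α e ≟ 0₄

allInMaxIdeal? : ∀ {n} → Decidable (AllInMaxIdeal {n})
allInMaxIdeal? α = all? (inMaxIdeal? ∘ α)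

modIndep-resp-≗ : ∀ {k n} (A : Mat k n) → M[ A ] Respects _≗_
modIndep-resp-≗ A X≗Y indep α supp = indep α λ e Xe → supp e (trans (sym (X≗Y e)) Xe)

modIndep-[I∣P]? : ∀ {k m} (P : Mat k m) → Decidable (M[ [I∣ P ] ])
modIndep-[I∣P]? {m = m} P X =
  map′ (Equivalence.from (modIndep-[I∣P]⇔ P X)) (Equivalence.to (modIndep-[I∣P]⇔ P X))
    (all-vectors? m all? resp λ β →
       supportedOn? X (kernelVector P β) →-dec allInMaxIdeal? (kernelVector P β))
  where
  resp : (λ β → SupportedOn X (kernelVector P β) → AllInMaxIdeal (kernelVector P β)) Respects _≗_
  resp β≗γ h supp e = subst InMaxIdeal (kernelVector-cong P β≗γ e)
    (h (λ e′ Xe′ → trans (kernelVector-cong P β≗γ e′) (supp e′ Xe′)) e)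

card-cong : ∀ {n} {X Y : Sub n} → X ≗ Y → card X ≡ card Y
card-cong {zero}            X≗Y = refl
card-cong {suc n} {X} {Y} X≗Y with X zero | Y zero | X≗Y zero
... | true  | .true  | refl = cong suc (card-cong (X≗Y ∘ suc))
... | false | .false | refl = card-cong (X≗Y ∘ suc)

sparsePaving4-resp-≗ : ∀ planes → SparsePaving4 planes Respects _≗_
sparsePaving4-resp-≗ planes X≗Y (inj₁ small) = inj₁ (subst (_≤ 3) (card-cong X≗Y) small)
sparsePaving4-resp-≗ planes X≗Y (inj₂ (four , notPlane)) =
  inj₂ (trans (sym (card-cong X≗Y)) four , notPlane ∘ Any.map λ isSet e → trans (X≗Y e) (isSet e))

sparsePaving4? : ∀ planes → Decidable (SparsePaving4 planes)
sparsePaving4? planes X =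
  card X ≤? 3 ⊎-dec (card X ℕ.≟ 4 ×-dec ¬? (Any.any? (λ p → all? λ e → X e Bool.≟ memb e p) planes))

IsIsomorphism : ∀ {n n′} → IndepSystem n → IndepSystem n′ → Fin n ↔ Fin n′ → Set
IsIsomorphism M N f = ∀ X → M X ⇔ N (λ y → X (Inverse.from f y))

isIsomorphism? : ∀ {n n′} {M : IndepSystem n} {N : IndepSystem n′} →
  M Respects _≗_ → N Respects _≗_ → Decidable M → Decidable N → Decidable (IsIsomorphism M N)
isIsomorphism? {n} {M = M} {N} respM respN M? N? f =
  all-vectors? n Bool-exhaustible resp λ X → M? X ⇔? N? (λ y → X (Inverse.from f y))
  where
  resp : (λ X → M X ⇔ N (λ y → X (Inverse.from f y))) Respects _≗_
  resp X≗Y M⇔N = mk⇔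
    (respN (X≗Y ∘ Inverse.from f) ∘ Equivalence.to M⇔N ∘ respM (sym ∘ X≗Y))
    (respM X≗Y ∘ Equivalence.from M⇔N ∘ respN (sym ∘ X≗Y ∘ Inverse.from f))

[I∣P]-freelyRepresentable : ∀ {k m} {M : IndepSystem (k + m)} (P : Mat k m) →
                            M ≅ M[ [I∣ P ] ] → FreelyRepresentableℤ₄ M
[I∣P]-freelyRepresentable {k} {m} P M≅ = k , m , P , [I∣ P ] , ↔-id _ , (λ _ _ → refl) , M≅

sparsePaving4≅? : ∀ planes (P : Mat 4 4) →
                  Decidable (IsIsomorphism (SparsePaving4 planes) M[ [I∣ P ] ])
sparsePaving4≅? planes P =
  isIsomorphism? (sparsePaving4-resp-≗ planes) (modIndep-resp-≗ [I∣ P ])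
                 (sparsePaving4? planes) (modIndep-[I∣P]? P)

matrix : ∀ {k m} → Vec (Vec ℤ₄ m) k → Mat k m
matrix rows i j = lookup (lookup rows i) j

F8-matrix : Mat 4 4
F8-matrix = matrix ( (2F ∷ 1F ∷ 3F ∷ 3F ∷ [])
                   ∷ (3F ∷ 2F ∷ 1F ∷ 1F ∷ [])
                   ∷ (2F ∷ 2F ∷ 2F ∷ 0F ∷ [])
                   ∷ (2F ∷ 2F ∷ 0F ∷ 2F ∷ [])
                   ∷ [])

F8-columns : Fin 8 ↔ Fin 8
F8-columns = mk↔ₛ′ column element
  (from-yes (all? λ c → column (element c) ≟ c)) (from-yes (all? λ x → element (column x) ≟ x))
  where
  column element : Fin 8 → Fin 8
  column  = lookup (0F ∷ 6F ∷ 5F ∷ 7F ∷ 1F ∷ 2F ∷ 4F ∷ 3F ∷ [])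
  element = lookup (0F ∷ 4F ∷ 5F ∷ 7F ∷ 6F ∷ 2F ∷ 1F ∷ 3F ∷ [])

AG32′-matrix : Mat 4 4
AG32′-matrix = matrix ( (3F ∷ 3F ∷ 0F ∷ 2F ∷ [])
                      ∷ (1F ∷ 0F ∷ 1F ∷ 2F ∷ [])
                      ∷ (3F ∷ 3F ∷ 3F ∷ 0F ∷ [])
                      ∷ (0F ∷ 1F ∷ 3F ∷ 2F ∷ [])
                      ∷ [])

AG32′-columns : Fin 8 ↔ Fin 8
AG32′-columns = mk↔ₛ′ swap swap involutive involutive
  where
  swap : Fin 8 → Fin 8
  swap = lookup (0F ∷ 2F ∷ 1F ∷ 4F ∷ 3F ∷ 5F ∷ 7F ∷ 6F ∷ [])
  involutive : ∀ x → swap (swap x) ≡ x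
  involutive = from-yes (all? λ x → swap (swap x) ≟ x)

proposition5p8 : FreelyRepresentableℤ₄ F8 × FreelyRepresentableℤ₄ AG32′
proposition5p8 =
    [I∣P]-freelyRepresentable F8-matrix
      (F8-columns , decided (sparsePaving4≅? _ F8-matrix F8-columns) refl)
  , [I∣P]-freelyRepresentable AG32′-matrix
      (AG32′-columns , decided (sparsePaving4≅? _ AG32′-matrix AG32′-columns) refl)
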